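{- Let $N$ be a positive integer with $\sigma^{**}(N)=3N$ and $3^3\mid N$, and let $e\ge 0$ be such that $2^e\,\|\,N$. Then $e\ge 4$.
   Context: $\sigma^{**}(N)$ is the sum of the biunitary divisors of $N$, where a divisor $d$ of $N$ is biunitary if the greatest common unitary divisor of $d$ and $N/d$ is $1$ (a divisor $d$ of $m$ being unitary if $\gcd(d,m/d)=1$). $p^a\,\|\,N$ means $p^a\mid N$ and $p^{a+1}\nmid N$. -}

module Defs where

open import Data.Nat using (ℕ; zero; suc; _+_; _*_; _^_; _≤_; _≟_)
open import Data.Nat.Divisibility using (_∣_; _∣?_)
open import Data.Empty using (⊥)
open import Relation.Binary.PropositionalEquality using (_≡_)
open import Data.Nat.Base using (_⊔_)
open import Data.Nat.DivMod using (_/_)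
open import Data.Nat.GCD using (gcd)
open import Data.List using (List; filter; upTo; foldr; map)
open import Data.Nat.ListAction using (sum)
open import Data.Product using (_×_)
open import Relation.Nullary using (¬_; Dec; yes; no)
open import Relation.Nullary.Decidable using (_×-dec_)

divisors : ℕ → List ℕ
divisors m = filter (_∣? m) (map suc (upTo m))

-- d is a unitary divisor of m (m > 0): d ∣ m and gcd(d, m/d) = 1.
-- For m = 0 the list of divisors is empty, so this is never used there.
isUnitaryDiv : ℕ → ℕ → Set
isUnitaryDiv m (suc k) = (suc k ∣ m) × (gcd (suc k) (m / suc k) ≡ 1)
isUnitaryDiv m zero = ⊥

isUnitaryDiv? : (m d : ℕ) → Dec (isUnitaryDiv m d)
isUnitaryDiv? m (suc k) = (suc k ∣? m) ×-dec (gcd (suc k) (m / suc k) ≟ 1)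
isUnitaryDiv? m zero = no (λ ())

unitaryDivisors : ℕ → List ℕ
unitaryDivisors m = filter (isUnitaryDiv? m) (divisors m)

gcud : ℕ → ℕ → ℕ
gcud a b = foldr _⊔_ 0 (filter (isUnitaryDiv? b) (unitaryDivisors a))

isBiunitaryDiv : ℕ → ℕ → Set
isBiunitaryDiv N zero = ⊥
isBiunitaryDiv N (suc k) = (suc k ∣ N) × (gcud (suc k) (N / suc k) ≡ 1)

isBiunitaryDiv? : (N d : ℕ) → Dec (isBiunitaryDiv N d)
isBiunitaryDiv? N zero = no (λ ())
isBiunitaryDiv? N (suc k) = (suc k ∣? N) ×-dec (gcud (suc k) (N / suc k) ≟ 1)

σ** : ℕ → ℕ
σ** N = sum (filter (isBiunitaryDiv? N) (divisors N))

_^_∥_ : ℕ → ℕ → ℕ → Set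
p ^ a ∥ N = (p ^ a ∣ N) × ¬ (p ^ suc a ∣ N)

-- For a prime p ∤ r, the biunitary divisors of p^k r are the products of those of p^k and
-- those of r, and p^i (i ≤ k) is a biunitary divisor of p^k unless i = k/2 > 0.  Hence
-- σ**(p^k r) = σ**(p^k) σ**(r), and for odd p and k ≥ 1 the sum σ**(p^k) has an even number
-- of odd terms, so σ**(t) is even for every odd t > 1.
--
-- Write N = 2^e 3^f t with f ≥ 3 and t coprime to 6, and suppose e ≤ 3.  In
-- σ**(2^e) σ**(3^f) σ**(t) = 3 · 2^e 3^f t we have σ**(2^e) ∈ {1, 3, 5, 15} and σ**(3^f) even,
-- so counting factors 2 rules out e = 0 and forces t = 1 when e = 1.  For e = 2 the factor 5
-- forces t = 5^g; for e = 3 it forces t = 5^g s, and s = 13^h when g = 2.  Each remaining case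
-- contradicts the bounds 4/3 < σ**(3^f)/3^f < 3/2 (> 13/9 unless f = 4) and their analogues
-- at 5 and 13.

module Submission where

open import Data.Bool using (true; false)
open import Data.List using (List; []; _∷_; _++_; filter; map; downFrom; cartesianProductWith)
open import Data.List.Membership.Propositional using (_∈_)
open import Data.List.Membership.Propositional.Properties
  using (∈-filter⁺; ∈-filter⁻; ∈-map⁺; ∈-map⁻; ∈-upTo⁺; ∈-downFrom⁺; ∈-downFrom⁻;
         ∈-cartesianProductWith⁺; ∈-cartesianProductWith⁻)
open import Data.List.Membership.Propositional.Properties.WithK using (unique∧set⇒bag)
open import Data.List.Properties using (foldr-forcesᵇ; foldr-preservesᵇ; filter-all; filter-accept)
open import Data.List.Relation.Binary.BagAndSetEquality using (∼bag⇒↭)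
open import Data.List.Relation.Binary.Disjoint.Propositional using (Disjoint)
open import Data.List.Relation.Binary.Permutation.Propositional using (_↭_)
import Data.List.Relation.Binary.Permutation.Propositional.Properties as ↭
import Data.List.Relation.Unary.All as All
open import Data.List.Relation.Unary.AllPairs using ([]; _∷_)
open import Data.List.Relation.Unary.Any using (here; there)
open import Data.List.Relation.Unary.Unique.Propositional using (Unique)
import Data.List.Relation.Unary.Unique.Propositional.Properties as Unique
open import Data.Nat using (ℕ; zero; suc; _+_; _*_; _^_; _∸_; _≤_; _<_; _≟_; z≤n; s≤s; z<s;
                            NonZero; ≢-nonZero⁻¹; >-nonZero; >-nonZero⁻¹)
open import Data.Nat.Coprimality using (Coprime; coprime-divisor; 1-coprimeTo; gcd≡1⇒coprime; coprime⇒gcd≡1)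
import Data.Nat.Coprimality as Coprime
open import Data.Nat.Divisibility
open import Data.Nat.DivMod using (_/_; m*[n/m]≡n; m*n/n≡m)
open import Data.Nat.GCD using (gcd)
open import Data.Nat.Induction using (<-wellFounded)
open import Data.Nat.ListAction using (sum; product)
open import Data.Nat.ListAction.Properties using (sum-++; sum-↭)
open import Data.Nat.Primality
  using (Prime; prime[2]; prime?; euclidsLemma; prime⇒irreducible; prime⇒nonTrivial; prime⇒nonZero; ¬prime[1])
open import Data.Nat.Primality.Factorisation using (factorise)
open import Data.Nat.Properties
open import Algebra.Properties.CommutativeSemigroup *-commutativeSemigroup using (x∙yz≈y∙xz)
open import Data.Nat.Tactic.RingSolver using (solve-∀)
open import Data.Product using (∃-syntax; ∃₂; _×_; _,_; proj₁; proj₂; map₁; <_,_>; uncurry)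
open import Data.Sum using (_⊎_; inj₁; inj₂)
open import Data.Unit using (tt)
open import Function.Base using (_∘_)
open import Function.Bundles using (_⇔_; mk⇔)
open import Induction.WellFounded using (Acc; acc)
open import Level using (0ℓ)
open import Relation.Binary.PropositionalEquality
open import Relation.Nullary using (¬_; yes; no; does; contradiction)
open import Relation.Nullary.Decidable using (_×-dec_; from-yes; from-no)
open import Relation.Unary using (Pred; Decidable)
open import Relation.Unary.Properties using (∁?)

open import Defs

private
  variable
    a b c d e i j k l m n o p r s t u w x y : ℕ

unique∧set⇒↭ : {A : Set} {xs ys : List A} → Unique xs → Unique ys →
               (∀ {z} → z ∈ xs ⇔ z ∈ ys) → xs ↭ ys
unique∧set⇒↭ xs! ys! same = ∼bag⇒↭ (unique∧set⇒bag xs! ys! same)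

unique-cartesianProductWith : {A B C : Set} {xs : List A} {ys : List B} (f : A → B → C) →
  (∀ {x y z} → f x y ≡ f x z → y ≡ z) →
  (∀ {w x y z} → y ∈ ys → z ∈ ys → f w y ≡ f x z → w ≡ x) →
  Unique xs → Unique ys → Unique (cartesianProductWith f xs ys)
unique-cartesianProductWith f _ _ [] _ = []
unique-cartesianProductWith {xs = x ∷ xs} {ys} f cancel determines (x∉xs ∷ xs!) ys! =
  Unique.++⁺ (Unique.map⁺ cancel ys!) (unique-cartesianProductWith f cancel determines xs! ys!) disjoint
  where
  disjoint : Disjoint (map (f x) ys) (cartesianProductWith f xs ys)
  disjoint (v∈fx[ys] , v∈rest) with ∈-map⁻ (f x) v∈fx[ys] | ∈-cartesianProductWith⁻ f xs ys v∈rest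
  ... | y , y∈ys , refl | w , z , w∈xs , z∈ys , eq = All.lookup x∉xs w∈xs (determines y∈ys z∈ys eq)

sum-cartesianProductWith : {A : Set} (f : A → ℕ) (xs : List A) (ys : List ℕ) →
  sum (cartesianProductWith (λ x y → f x * y) xs ys) ≡ sum (map f xs) * sum ys
sum-cartesianProductWith f []       ys = refl
sum-cartesianProductWith f (x ∷ xs) ys = begin
  sum (map (f x *_) ys ++ rest)            ≡⟨ sum-++ (map (f x *_) ys) rest ⟩
  sum (map (f x *_) ys) + sum rest         ≡⟨ cong₂ _+_ (sum-map-* (f x) ys) (sum-cartesianProductWith f xs ys) ⟩
  f x * sum ys + sum (map f xs) * sum ys   ≡⟨ *-distribʳ-+ (sum ys) (f x) _ ⟨
  (f x + sum (map f xs)) * sum ys          ∎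
  where
  open ≡-Reasoning
  rest = cartesianProductWith (λ x y → f x * y) xs ys
  sum-map-* : ∀ c ys → sum (map (c *_) ys) ≡ c * sum ys
  sum-map-* c []       = sym (*-zeroʳ c)
  sum-map-* c (y ∷ ys) = trans (cong (c * y +_) (sum-map-* c ys)) (sym (*-distribˡ-+ c y (sum ys)))

sum-map-filter-≤ : {A : Set} {P : Pred A 0ℓ} (f : A → ℕ) (P? : Decidable P) (xs : List A) →
                   sum (map f (filter P? xs)) ≤ sum (map f xs)
sum-map-filter-≤ f P? []       = z≤n
sum-map-filter-≤ f P? (x ∷ xs) with does (P? x)
... | true  = +-monoʳ-≤ (f x) (sum-map-filter-≤ f P? xs)
... | false = ≤-trans (sum-map-filter-≤ f P? xs) (m≤n+m _ (f x))

∈⇒≤sum : ∀ xs → x ∈ xs → x ≤ sum xs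
∈⇒≤sum (y ∷ ys) (here refl) = m≤m+n y (sum ys)
∈⇒≤sum (y ∷ ys) (there x∈) = ≤-trans (∈⇒≤sum ys x∈) (m≤n+m (sum ys) y)

-- Primes and p-adic decomposition

prime≢1 : Prime p → p ≢ 1
prime≢1 p-prime refl = ¬prime[1] p-prime

prime∤1 : Prime p → ¬ p ∣ 1
prime∤1 p-prime p∣1 = prime≢1 p-prime (∣1⇒≡1 p∣1)

prime^≢1 : Prime p → ∀ i → 0 < i → p ^ i ≢ 1
prime^≢1 {p} p-prime (suc i) _ pⁱ≡1 = prime∤1 p-prime (subst (p ∣_) pⁱ≡1 (m∣m*n (p ^ i)))

prime3 : Prime 3
prime3 = from-yes (prime? 3)

prime5 : Prime 5
prime5 = from-yes (prime? 5)

prime13 : Prime 13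
prime13 = from-yes (prime? 13)

prime-factor : 1 < n → ∃[ q ] Prime q × q ∣ n
prime-factor {n} 1<n with factorise n {{>-nonZero (<-trans z<s 1<n)}}
... | record { factors = [] ; isFactorisation = n≡1 } = contradiction n≡1 (>⇒≢ 1<n)
... | record { factors = q ∷ qs ; isFactorisation = n≡q*qs ; factorsPrime = q-prime All.∷ _ } =
  q , q-prime , divides (product qs) (trans n≡q*qs (*-comm q (product qs)))

∤⇒nonZero : ¬ p ∣ n → NonZero n
∤⇒nonZero {n = zero}  p∤0 = contradiction (_ ∣0) p∤0
∤⇒nonZero {n = suc n} _   = _

*≡nonZero⇒nonZeroˡ : ∀ m {n o} → .{{NonZero o}} → m * n ≡ o → NonZero m
*≡nonZero⇒nonZeroˡ m refl = m*n≢0⇒m≢0 m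

*≡nonZero⇒nonZeroʳ : ∀ m {n o} → .{{NonZero o}} → m * n ≡ o → NonZero n
*≡nonZero⇒nonZeroʳ m refl = m*n≢0⇒n≢0 m

*≡⇒∣ʳ : m * n ≡ o → n ∣ o
*≡⇒∣ʳ {m} eq = divides m (sym eq)

prime∤⇒coprime : Prime p → ¬ p ∣ n → Coprime p n
prime∤⇒coprime p-prime p∤n (d∣p , d∣n) with prime⇒irreducible p-prime d∣p
... | inj₁ d≡1  = d≡1
... | inj₂ refl = contradiction d∣n p∤n

coprime-*ˡ : Coprime a c → Coprime b c → Coprime (a * b) c
coprime-*ˡ {a} {c} a⊥c b⊥c {d} (d∣ab , d∣c) = b⊥c (coprime-divisor d⊥a d∣ab , d∣c)
  where
  d⊥a : Coprime d a
  d⊥a (e∣d , e∣a) = a⊥c (e∣a , ∣-trans e∣d d∣c)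

coprime-^ˡ : Coprime a c → ∀ i → Coprime (a ^ i) c
coprime-^ˡ a⊥c zero    (d∣1 , _) = ∣1⇒≡1 d∣1
coprime-^ˡ a⊥c (suc i) = coprime-*ˡ a⊥c (coprime-^ˡ a⊥c i)

prime∤-* : Prime p → ¬ p ∣ m → ¬ p ∣ n → ¬ p ∣ m * n
prime∤-* {m = m} {n} p-prime p∤m p∤n p∣mn with euclidsLemma m n p-prime p∣mn
... | inj₁ p∣m = p∤m p∣m
... | inj₂ p∣n = p∤n p∣n

prime∤-^ : Prime p → ¬ p ∣ m → ∀ i → ¬ p ∣ m ^ i
prime∤-^ p-prime p∤m i p∣mⁱ =
  prime≢1 p-prime (coprime-^ˡ (Coprime.sym (prime∤⇒coprime p-prime p∤m)) i (p∣mⁱ , ∣-refl))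

prime∣m*[n*x]⇒∣x : Prime p → ¬ p ∣ m → ¬ p ∣ n → p ∣ m * (n * x) → p ∣ x
prime∣m*[n*x]⇒∣x p-prime p∤m p∤n p∣mnx =
  coprime-divisor (prime∤⇒coprime p-prime p∤n) (coprime-divisor (prime∤⇒coprime p-prime p∤m) p∣mnx)

prime∣-cofactor : Prime p → ¬ p ∣ m → ¬ p ∣ n → p * x ≡ m * (n * y) → p ∣ y
prime∣-cofactor {p} {x = x} p-prime p∤m p∤n eq =
  prime∣m*[n*x]⇒∣x p-prime p∤m p∤n (subst (p ∣_) eq (m∣m*n x))

p^i*n≢0 : Prime p → ¬ p ∣ n → ∀ i → NonZero (p ^ i * n)
p^i*n≢0 {p} {n} p-prime p∤n i = m*n≢0 (p ^ i) n
  where instance _ = prime⇒nonZero p-prime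
                 _ = m^n≢0 p i
                 _ = ∤⇒nonZero p∤n

parity : ∀ n → (∃[ c ] n ≡ c * 2) ⊎ (∃[ c ] n ≡ suc (c * 2))
parity zero = inj₁ (0 , refl)
parity (suc n) with parity n
... | inj₁ (c , refl) = inj₂ (c , refl)
... | inj₂ (c , refl) = inj₁ (suc c , refl)

odd⇒2∣suc : ¬ 2 ∣ n → 2 ∣ suc n
odd⇒2∣suc {n} 2∤n with parity n
... | inj₁ (c , refl) = contradiction (divides c refl) 2∤n
... | inj₂ (c , refl) = divides (suc c) refl

odd-* : ¬ 2 ∣ m → ¬ 2 ∣ n → ¬ 2 ∣ m * n
odd-* = prime∤-* prime[2]

2^[1+n]∤2^n*odd : ∀ n → ¬ 2 ∣ m → ¬ 2 ^ suc n ∣ 2 ^ n * m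
2^[1+n]∤2^n*odd {m} n m-odd 2ⁿ⁺¹∣2ⁿm =
  m-odd (*-cancelˡ-∣ (2 ^ n) {{m^n≢0 2 n}} (subst (_∣ 2 ^ n * m) (*-comm 2 (2 ^ n)) 2ⁿ⁺¹∣2ⁿm))

8∣w*[x*[y*z]] : ∀ w {x y z} → 2 ∣ x → 2 ∣ y → 2 ∣ z → 8 ∣ w * (x * (y * z))
8∣w*[x*[y*z]] w 2∣x 2∣y 2∣z = ∣n⇒∣m*n w (*-pres-∣ 2∣x (*-pres-∣ 2∣y 2∣z))

n+n≡n*2 : ∀ n → n + n ≡ n * 2
n+n≡n*2 n = trans (cong (n +_) (sym (+-identityʳ n))) (*-comm 2 n)

*2≢1+*2 : ∀ i c → i * 2 ≢ suc (c * 2)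
*2≢1+*2 zero    c       ()
*2≢1+*2 (suc i) zero    ()
*2≢1+*2 (suc i) (suc c) eq = *2≢1+*2 i c (suc-injective (suc-injective eq))

p∣p^[1+i]*n : ∀ p i n → p ∣ p ^ suc i * n
p∣p^[1+i]*n p i n = ∣m⇒∣m*n n (m∣m*n (p ^ i))

p-adic-split : Prime p → ∀ x → .{{NonZero x}} → ∃₂ λ a y → ¬ p ∣ y × x ≡ p ^ a * y
p-adic-split {p} p-prime x = go x (<-wellFounded x)
  where
  instance _ = prime⇒nonTrivial p-prime
  go : ∀ x → Acc _<_ x → .{{NonZero x}} → ∃₂ λ a y → ¬ p ∣ y × x ≡ p ^ a * y
  go x (acc rec) with p ∣? x
  ... | no p∤x = 0 , x , p∤x , sym (*-identityˡ x)
  ... | yes p∣x with go (quotient p∣x) (rec (quotient-< p∣x)) {{quotient≢0 p∣x}}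
  ...   | a , y , p∤y , q≡pᵃy = suc a , y , p∤y , (begin
    x                  ≡⟨ m∣n⇒n≡m*quotient p∣x ⟩
    p * quotient p∣x   ≡⟨ cong (p *_) q≡pᵃy ⟩
    p * (p ^ a * y)    ≡⟨ *-assoc p (p ^ a) y ⟨
    p ^ suc a * y      ∎)
    where open ≡-Reasoning

p-adic-split-unique : Prime p → ¬ p ∣ x → ¬ p ∣ y → ∀ a b → p ^ a * x ≡ p ^ b * y → a ≡ b × x ≡ y
p-adic-split-unique {p} {x} {y} _ _ _ zero zero eq = refl , *-cancelˡ-≡ x y 1 eq
p-adic-split-unique {p} {x} {y} _ p∤x _ zero (suc b) eq =
  contradiction (subst (p ∣_) (trans (sym eq) (*-identityˡ x)) (p∣p^[1+i]*n p b y)) p∤x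
p-adic-split-unique {p} {x} {y} _ _ p∤y (suc a) zero eq =
  contradiction (subst (p ∣_) (trans eq (*-identityˡ y)) (p∣p^[1+i]*n p a x)) p∤y
p-adic-split-unique {p} {x} {y} p-prime p∤x p∤y (suc a) (suc b) eq =
  map₁ (cong suc) (p-adic-split-unique p-prime p∤x p∤y a b
    (*-cancelˡ-≡ (p ^ a * x) (p ^ b * y) p {{prime⇒nonZero p-prime}} (begin
      p * (p ^ a * x)    ≡⟨ *-assoc p (p ^ a) x ⟨
      p ^ suc a * x      ≡⟨ eq ⟩
      p ^ suc b * y      ≡⟨ *-assoc p (p ^ b) y ⟩
      p * (p ^ b * y)    ∎)))
  where open ≡-Reasoning

p-adic-split-∣ : Prime p → .{{NonZero x}} → p ^ a ∣ x → ∃₂ λ g y → ¬ p ∣ y × x ≡ p ^ (a + g) * y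
p-adic-split-∣ {p} {x} {a} p-prime (divides q x≡q*pᵃ)
  with p-adic-split p-prime q {{*≡nonZero⇒nonZeroˡ q (sym x≡q*pᵃ)}}
... | g , y , p∤y , refl = g , y , p∤y , (begin
  x                     ≡⟨ x≡q*pᵃ ⟩
  p ^ g * y * p ^ a     ≡⟨ *-comm (p ^ g * y) (p ^ a) ⟩
  p ^ a * (p ^ g * y)   ≡⟨ *-assoc (p ^ a) (p ^ g) y ⟨
  p ^ a * p ^ g * y     ≡⟨ cong (_* y) (^-distribˡ-+-* p a g) ⟨
  p ^ (a + g) * y       ∎)
  where open ≡-Reasoning

∥⇒p-adic-split : p ^ a ∥ n → ∃[ m ] ¬ p ∣ m × n ≡ p ^ a * m
∥⇒p-adic-split {p} {a} (divides m n≡m*pᵃ , pᵃ⁺¹∤n) = m , p∤m , trans n≡m*pᵃ (*-comm m (p ^ a))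
  where
  p∤m : ¬ p ∣ m
  p∤m (divides q m≡q*p) =
    pᵃ⁺¹∤n (divides q (trans n≡m*pᵃ (trans (cong (_* p ^ a) m≡q*p) (*-assoc q p (p ^ a)))))

[p^a*x]*[p^b*y]≡p^[a+b]*[x*y] : ∀ p a b x y → p ^ a * x * (p ^ b * y) ≡ p ^ (a + b) * (x * y)
[p^a*x]*[p^b*y]≡p^[a+b]*[x*y] p a b x y = begin
  p ^ a * x * (p ^ b * y)   ≡⟨ [m*n]*[o*p]≡[m*o]*[n*p] (p ^ a) x (p ^ b) y ⟩
  p ^ a * p ^ b * (x * y)   ≡⟨ cong (_* (x * y)) (^-distribˡ-+-* p a b) ⟨
  p ^ (a + b) * (x * y)     ∎
  where open ≡-Reasoning

-- Unitary divisors

infix 4 _‖_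

_‖_ : ℕ → ℕ → Set
u ‖ m = ∃[ v ] u * v ≡ m × Coprime u v

UnitarilyCoprime : ℕ → ℕ → Set
UnitarilyCoprime d e = ∀ {u} → u ‖ d → u ‖ e → u ≡ 1

‖⇒∣ : u ‖ m → u ∣ m
‖⇒∣ {u} (v , uv≡m , _) = divides v (trans (sym uv≡m) (*-comm u v))

‖⇒nonZero : .{{NonZero m}} → u ‖ m → NonZero u
‖⇒nonZero {u = u} (v , refl , _) = m*n≢0⇒m≢0 u

coprime⇒‖ : Coprime u n → u ‖ u * n
coprime⇒‖ {n = n} u⊥n = n , refl , u⊥n

‖-lift : Prime p → ¬ p ∣ d → u ‖ d → ∀ i → u ‖ p ^ i * d
‖-lift {p} {d} {u} p-prime p∤d u‖d@(v , uv≡d , u⊥v) i =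
  p ^ i * v , trans (x∙yz≈y∙xz u (p ^ i) v) (cong (p ^ i *_) uv≡d) , u⊥pⁱv
  where
  p∤u : ¬ p ∣ u
  p∤u p∣u = p∤d (∣-trans p∣u (‖⇒∣ u‖d))
  u⊥pⁱv : Coprime u (p ^ i * v)
  u⊥pⁱv = Coprime.sym (coprime-*ˡ (coprime-^ˡ (prime∤⇒coprime p-prime p∤u) i) (Coprime.sym u⊥v))

coprime⇒exponent≡0 : Prime p → Coprime (p ^ j * u) (p ^ l * w) → j ≡ 0 ⊎ l ≡ 0
coprime⇒exponent≡0 {j = zero}             _ _ = inj₁ refl
coprime⇒exponent≡0 {j = suc _} {l = zero} _ _ = inj₂ refl
coprime⇒exponent≡0 {p} {suc j} {u} {suc l} {w} p-prime cop =
  contradiction (cop (p∣p^[1+i]*n p j u , p∣p^[1+i]*n p l w)) (prime≢1 p-prime)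

‖-p-adic : Prime p → ¬ p ∣ d → ¬ p ∣ u → ∀ i j →
           p ^ j * u ‖ p ^ i * d → u ‖ d × (j ≡ 0 ⊎ j ≡ i)
‖-p-adic {p} {d} {u} p-prime p∤d p∤u i j (v , eq , pʲu⊥v)
  with p-adic-split p-prime v {{*≡nonZero⇒nonZeroʳ (p ^ j * u) {{p^i*n≢0 p-prime p∤d i}} eq}}
... | l , w , p∤w , refl = (w , proj₂ split , u⊥w) , exponent
  where
  open ≡-Reasoning
  split : j + l ≡ i × u * w ≡ d
  split = p-adic-split-unique p-prime (prime∤-* p-prime p∤u p∤w) p∤d (j + l) i (begin
    p ^ (j + l) * (u * w)   ≡⟨ [p^a*x]*[p^b*y]≡p^[a+b]*[x*y] p j l u w ⟨
    p ^ j * u * (p ^ l * w) ≡⟨ eq ⟩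
    p ^ i * d               ∎)
  u⊥w : Coprime u w
  u⊥w (g∣u , g∣w) = pʲu⊥v (∣n⇒∣m*n (p ^ j) g∣u , ∣n⇒∣m*n (p ^ l) g∣w)
  exponent : j ≡ 0 ⊎ j ≡ i
  exponent with coprime⇒exponent≡0 {j = j} {l = l} p-prime pʲu⊥v
  ... | inj₁ j≡0  = inj₁ j≡0
  ... | inj₂ refl = inj₂ (trans (sym (+-identityʳ j)) (proj₁ split))

common-exponent≡0 : ¬ (i ≡ l × 0 < i) → j ≡ 0 ⊎ j ≡ i → j ≡ 0 ⊎ j ≡ l → j ≡ 0
common-exponent≡0 _ (inj₁ j≡0) _          = j≡0
common-exponent≡0 _ (inj₂ _)   (inj₁ j≡0) = j≡0
common-exponent≡0 {j = zero}  _   (inj₂ _)    (inj₂ _)    = refl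
common-exponent≡0 {j = suc _} i≢l (inj₂ refl) (inj₂ refl) = contradiction (refl , s≤s z≤n) i≢l

unitarilyCoprime-p^⁻ : Prime p → ¬ p ∣ d → ¬ p ∣ e → ∀ i l →
                       UnitarilyCoprime (p ^ i * d) (p ^ l * e) →
                       ¬ (i ≡ l × 0 < i) × UnitarilyCoprime d e
unitarilyCoprime-p^⁻ {p} {d} {e} p-prime p∤d p∤e i l uc =
  no-common-power , λ u‖d u‖e → uc (‖-lift p-prime p∤d u‖d i) (‖-lift p-prime p∤e u‖e l)
  where
  pⁱ‖ : ∀ {n} → ¬ p ∣ n → p ^ i ‖ p ^ i * n
  pⁱ‖ p∤n = coprime⇒‖ (coprime-^ˡ (prime∤⇒coprime p-prime p∤n) i)
  no-common-power : ¬ (i ≡ l × 0 < i)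
  no-common-power (refl , 0<i) = prime^≢1 p-prime i 0<i (uc (pⁱ‖ p∤d) (pⁱ‖ p∤e))

unitarilyCoprime-p^⁺ : Prime p → ¬ p ∣ d → ¬ p ∣ e → ∀ i l →
                       ¬ (i ≡ l × 0 < i) → UnitarilyCoprime d e →
                       UnitarilyCoprime (p ^ i * d) (p ^ l * e)
unitarilyCoprime-p^⁺ {p} {d} {e} p-prime p∤d p∤e i l i≢l uc {u} u‖pⁱd u‖pˡe
  with p-adic-split p-prime u {{‖⇒nonZero {{p^i*n≢0 p-prime p∤d i}} u‖pⁱd}}
... | j , u′ , p∤u′ , refl
  with ‖-p-adic p-prime p∤d p∤u′ i j u‖pⁱd | ‖-p-adic p-prime p∤e p∤u′ l j u‖pˡe
... | u′‖d , j∈[0,i] | u′‖e , j∈[0,l] =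
  cong₂ (λ k v → p ^ k * v) (common-exponent≡0 i≢l j∈[0,i] j∈[0,l]) (uc u′‖d u′‖e)

∈-divisors⁺ : .{{NonZero m}} → suc k ∣ m → suc k ∈ divisors m
∈-divisors⁺ {m} 1+k∣m = ∈-filter⁺ (_∣? m) (∈-map⁺ suc (∈-upTo⁺ (∣⇒≤ 1+k∣m))) 1+k∣m

divisors-unique : ∀ m → Unique (divisors m)
divisors-unique m = Unique.filter⁺ (_∣? m) (Unique.map⁺ suc-injective (Unique.upTo⁺ m))

isUnitaryDiv⇒‖ : isUnitaryDiv m u → u ‖ m
isUnitaryDiv⇒‖ {m} {suc k} (1+k∣m , gcd≡1) = m / suc k , m*[n/m]≡n 1+k∣m , gcd≡1⇒coprime gcd≡1

‖⇒isUnitaryDiv : .{{NonZero m}} → u ‖ m → isUnitaryDiv m u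
‖⇒isUnitaryDiv {u = zero}  u‖m = contradiction refl (≢-nonZero⁻¹ 0 {{‖⇒nonZero u‖m}})
‖⇒isUnitaryDiv {u = suc k} (v , refl , u⊥v) =
  m∣m*n v , trans (cong (gcd (suc k)) (trans (cong (_/ suc k) (*-comm (suc k) v)) (m*n/n≡m v (suc k))))
                  (coprime⇒gcd≡1 u⊥v)

commonUnitaryDivisors : ℕ → ℕ → List ℕ
commonUnitaryDivisors a b = filter (isUnitaryDiv? b) (unitaryDivisors a)

∈-commonUnitaryDivisors⁺ : .{{NonZero a}} → .{{NonZero b}} → u ‖ a → u ‖ b → u ∈ commonUnitaryDivisors a b
∈-commonUnitaryDivisors⁺ {u = zero} u‖a _ = contradiction refl (≢-nonZero⁻¹ 0 {{‖⇒nonZero u‖a}})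
∈-commonUnitaryDivisors⁺ {a} {b} {suc k} u‖a u‖b =
  ∈-filter⁺ (isUnitaryDiv? b) (∈-filter⁺ (isUnitaryDiv? a) (∈-divisors⁺ (‖⇒∣ u‖a)) (‖⇒isUnitaryDiv u‖a))
            (‖⇒isUnitaryDiv u‖b)

∈-commonUnitaryDivisors⁻ : u ∈ commonUnitaryDivisors a b → u ‖ a × u ‖ b
∈-commonUnitaryDivisors⁻ {a = a} {b} u∈ with ∈-filter⁻ (isUnitaryDiv? b) {xs = unitaryDivisors a} u∈
... | u∈ua , u‖ᵇb with ∈-filter⁻ (isUnitaryDiv? a) {xs = divisors a} u∈ua
... | _ , u‖ᵇa = isUnitaryDiv⇒‖ u‖ᵇa , isUnitaryDiv⇒‖ u‖ᵇb

≤-gcud : u ∈ commonUnitaryDivisors a b → u ≤ gcud a b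
≤-gcud {a = a} {b} = All.lookup (foldr-forcesᵇ (λ x y → < m⊔n≤o⇒m≤o x y , m⊔n≤o⇒n≤o x y >)
                                               0 (commonUnitaryDivisors a b) ≤-refl)

gcud≡1⇒unitarilyCoprime : .{{NonZero a}} → .{{NonZero b}} → gcud a b ≡ 1 → UnitarilyCoprime a b
gcud≡1⇒unitarilyCoprime {a} {b} gcud≡1 u‖a u‖b =
  ≤-antisym (subst (_ ≤_) gcud≡1 (≤-gcud {a = a} {b} (∈-commonUnitaryDivisors⁺ u‖a u‖b)))
            (>-nonZero⁻¹ _ {{‖⇒nonZero u‖a}})

unitarilyCoprime⇒gcud≡1 : .{{NonZero a}} → .{{NonZero b}} → UnitarilyCoprime a b → gcud a b ≡ 1
unitarilyCoprime⇒gcud≡1 {a} {b} uc = ≤-antisym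
  (foldr-preservesᵇ ⊔-lub z≤n
     (All.tabulate (λ u∈ → ≤-reflexive (uncurry uc (∈-commonUnitaryDivisors⁻ u∈)))))
  (≤-gcud {a = a} {b} (∈-commonUnitaryDivisors⁺ (1‖ a) (1‖ b)))
  where
  1‖ : ∀ m → 1 ‖ m
  1‖ m = m , *-identityˡ m , 1-coprimeTo m

biunitaryDivisors : ℕ → List ℕ
biunitaryDivisors n = filter (isBiunitaryDiv? n) (divisors n)

biunitaryDivisors-unique : ∀ n → Unique (biunitaryDivisors n)
biunitaryDivisors-unique n = Unique.filter⁺ (isBiunitaryDiv? n) (divisors-unique n)

∈-biunitaryDivisors⁺ : .{{NonZero n}} → d * e ≡ n → UnitarilyCoprime d e → d ∈ biunitaryDivisors n
∈-biunitaryDivisors⁺ {d = zero} refl _ = contradiction refl (≢-nonZero⁻¹ 0)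
∈-biunitaryDivisors⁺ {d = suc k} {e} refl uc =
  ∈-filter⁺ (isBiunitaryDiv? _) (∈-divisors⁺ (m∣m*n e))
            (m∣m*n e , subst (λ x → gcud (suc k) x ≡ 1) (sym e≡n/d)
                             (unitarilyCoprime⇒gcud≡1 {{_}} {{e≢0}} uc))
  where
  e≢0 = m*n≢0⇒n≢0 (suc k)
  e≡n/d : suc k * e / suc k ≡ e
  e≡n/d = trans (cong (_/ suc k) (*-comm (suc k) e)) (m*n/n≡m e (suc k))

∈-biunitaryDivisors⁻ : .{{NonZero n}} → d ∈ biunitaryDivisors n → ∃[ e ] d * e ≡ n × UnitarilyCoprime d e
∈-biunitaryDivisors⁻ {n} {d} d∈ = biunitary d (proj₂ (∈-filter⁻ (isBiunitaryDiv? n) {xs = divisors n} d∈))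
  where
  biunitary : ∀ d → isBiunitaryDiv n d → ∃[ e ] d * e ≡ n × UnitarilyCoprime d e
  biunitary (suc k) (1+k∣n , gcud≡1) =
    n / suc k , d*e≡n , gcud≡1⇒unitarilyCoprime {{_}} {{*≡nonZero⇒nonZeroʳ (suc k) d*e≡n}} gcud≡1
    where d*e≡n = m*[n/m]≡n 1+k∣n

-- σ** of p ^ k * r

NonzeroHalf : ℕ → ℕ → Set
NonzeroHalf k i = i + i ≡ k × 0 < i

nonzeroHalf? : ∀ k → Decidable (NonzeroHalf k)
nonzeroHalf? k i = (i + i ≟ k) ×-dec (0 <? i)

biunitaryExponents : ℕ → List ℕ
biunitaryExponents k = filter (∁? (nonzeroHalf? k)) (downFrom (suc k))

biunitaryPowerSum : ℕ → ℕ → ℕ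
biunitaryPowerSum p k = sum (map (p ^_) (biunitaryExponents k))

∈-biunitaryExponents⁺ : i ≤ k → ¬ NonzeroHalf k i → i ∈ biunitaryExponents k
∈-biunitaryExponents⁺ i≤k not-half = ∈-filter⁺ (∁? (nonzeroHalf? _)) (∈-downFrom⁺ (s≤s i≤k)) not-half

∈-biunitaryExponents⁻ : i ∈ biunitaryExponents k → i ≤ k × ¬ NonzeroHalf k i
∈-biunitaryExponents⁻ {k = k} i∈ with ∈-filter⁻ (∁? (nonzeroHalf? k)) {xs = downFrom (suc k)} i∈
... | i∈downFrom , not-half = ≤-pred (∈-downFrom⁻ i∈downFrom) , not-half

biunitaryExponents-unique : ∀ k → Unique (biunitaryExponents k)
biunitaryExponents-unique k = Unique.filter⁺ (∁? (nonzeroHalf? k)) (Unique.downFrom⁺ (suc k))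

biunitaryDivisors-p^k*r : Prime p → ¬ p ∣ r → ∀ k →
  biunitaryDivisors (p ^ k * r) ↭
  cartesianProductWith (λ i d → p ^ i * d) (biunitaryExponents k) (biunitaryDivisors r)
biunitaryDivisors-p^k*r {p} {r} p-prime p∤r k =
  unique∧set⇒↭ (biunitaryDivisors-unique (p ^ k * r)) products-unique (mk⇔ to from)
  where
  instance
    _ = prime⇒nonZero p-prime
    _ = ∤⇒nonZero p∤r
    _ = p^i*n≢0 p-prime p∤r k
  f : ℕ → ℕ → ℕ
  f i d = p ^ i * d
  products = cartesianProductWith f (biunitaryExponents k) (biunitaryDivisors r)

  p∤∈ : d ∈ biunitaryDivisors r → ¬ p ∣ d
  p∤∈ {d} d∈ p∣d with ∈-biunitaryDivisors⁻ {n = r} d∈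
  ... | e , de≡r , _ = p∤r (∣-trans p∣d (*≡⇒∣ʳ {m = e} (trans (*-comm e d) de≡r)))

  products-unique : Unique products
  products-unique = unique-cartesianProductWith f
    (λ {i} → *-cancelˡ-≡ _ _ (p ^ i) {{m^n≢0 p i}})
    (λ d∈ d′∈ eq → proj₁ (p-adic-split-unique p-prime (p∤∈ d∈) (p∤∈ d′∈) _ _ eq))
    (biunitaryExponents-unique k) (biunitaryDivisors-unique r)

  to : x ∈ biunitaryDivisors (p ^ k * r) → x ∈ products
  to {x} x∈ with ∈-biunitaryDivisors⁻ {n = p ^ k * r} x∈
  ... | y , xy≡n , uc
    with p-adic-split p-prime x {{*≡nonZero⇒nonZeroˡ x xy≡n}}
       | p-adic-split p-prime y {{*≡nonZero⇒nonZeroʳ x xy≡n}}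
  ... | i , d , p∤d , refl | l , e , p∤e , refl
    with p-adic-split-unique p-prime (prime∤-* p-prime p∤d p∤e) p∤r (i + l) k
           (trans (sym ([p^a*x]*[p^b*y]≡p^[a+b]*[x*y] p i l d e)) xy≡n)
  ... | i+l≡k , de≡r with unitarilyCoprime-p^⁻ p-prime p∤d p∤e i l uc
  ... | i≢l , d⊥ᵤe = ∈-cartesianProductWith⁺ f
        (∈-biunitaryExponents⁺ (subst (i ≤_) i+l≡k (m≤m+n i l)) not-half)
        (∈-biunitaryDivisors⁺ de≡r d⊥ᵤe)
    where
    not-half : ¬ NonzeroHalf k i
    not-half (i+i≡k , 0<i) = i≢l (+-cancelˡ-≡ i i l (trans i+i≡k (sym i+l≡k)) , 0<i)

  from : x ∈ products → x ∈ biunitaryDivisors (p ^ k * r)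
  from x∈ with ∈-cartesianProductWith⁻ f (biunitaryExponents k) (biunitaryDivisors r) x∈
  ... | i , d , i∈ , d∈ , refl with ∈-biunitaryExponents⁻ i∈ | ∈-biunitaryDivisors⁻ {n = r} d∈
  ... | i≤k , not-half | e , de≡r , d⊥ᵤe =
    ∈-biunitaryDivisors⁺ factors (unitarilyCoprime-p^⁺ p-prime (p∤∈ d∈) p∤e i (k ∸ i) not-equal d⊥ᵤe)
    where
    p∤e : ¬ p ∣ e
    p∤e p∣e = p∤r (∣-trans p∣e (*≡⇒∣ʳ {m = d} de≡r))
    factors : p ^ i * d * (p ^ (k ∸ i) * e) ≡ p ^ k * r
    factors = trans ([p^a*x]*[p^b*y]≡p^[a+b]*[x*y] p i (k ∸ i) d e)
                    (cong₂ (λ a b → p ^ a * b) (m+[n∸m]≡n i≤k) de≡r)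
    not-equal : ¬ (i ≡ k ∸ i × 0 < i)
    not-equal (i≡k∸i , 0<i) = not-half (trans (cong (i +_) i≡k∸i) (m+[n∸m]≡n i≤k) , 0<i)

σ**-p^k*r : Prime p → ¬ p ∣ r → ∀ k → σ** (p ^ k * r) ≡ biunitaryPowerSum p k * σ** r
σ**-p^k*r {p} {r} p-prime p∤r k =
  trans (sum-↭ (biunitaryDivisors-p^k*r p-prime p∤r k))
        (sum-cartesianProductWith (p ^_) (biunitaryExponents k) (biunitaryDivisors r))

σ**[1] : σ** 1 ≡ 1
σ**[1] = refl

σ**-p^k*1 : Prime p → ∀ k → σ** (p ^ k * 1) ≡ biunitaryPowerSum p k
σ**-p^k*1 {p} p-prime k = trans (σ**-p^k*r p-prime (prime∤1 p-prime) k)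
                                (trans (cong (biunitaryPowerSum p k *_) σ**[1]) (*-identityʳ _))

σ**-≥ : .{{NonZero n}} → n ≤ σ** n
σ**-≥ {n} = ∈⇒≤sum (biunitaryDivisors n)
  (∈-biunitaryDivisors⁺ (*-identityʳ n) λ _ (v , uv≡1 , _) → m*n≡1⇒m≡1 _ v uv≡1)

-- Parity and size of σ**(p ^ k)

geometricSum : ℕ → ℕ → ℕ
geometricSum p n = sum (map (p ^_) (downFrom n))

geometricSum-even : ¬ 2 ∣ p → ∀ c → 2 ∣ geometricSum p (c * 2)
geometricSum-even p-odd zero = 2 ∣0
geometricSum-even {p} p-odd (suc c) =
  subst (2 ∣_) (+-assoc (p ^ suc (c * 2)) (p ^ (c * 2)) (geometricSum p (c * 2)))
        (∣m∣n⇒∣m+n consecutive-even (geometricSum-even p-odd c))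
  where
  consecutive-even : 2 ∣ p ^ suc (c * 2) + p ^ (c * 2)
  consecutive-even = subst (2 ∣_) (+-comm (p ^ (c * 2)) (p ^ suc (c * 2)))
                           (∣m⇒∣m*n (p ^ (c * 2)) (odd⇒2∣suc p-odd))

biunitaryExponents-odd : ∀ c → biunitaryExponents (suc (c * 2)) ≡ downFrom (suc (suc (c * 2)))
biunitaryExponents-odd c = filter-all (∁? (nonzeroHalf? _))
  (All.tabulate λ {i} _ (i+i≡k , _) → *2≢1+*2 i c (trans (sym (n+n≡n*2 i)) i+i≡k))

downFrom↭half∷biunitaryExponents : ∀ c → downFrom (suc (suc c * 2)) ↭ suc c ∷ biunitaryExponents (suc c * 2)
downFrom↭half∷biunitaryExponents c =
  unique∧set⇒↭ (Unique.downFrom⁺ _) (half∉ ∷ biunitaryExponents-unique (suc c * 2)) (mk⇔ to from)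
  where
  half∉ : All.All (suc c ≢_) (biunitaryExponents (suc c * 2))
  half∉ = All.tabulate λ c+1∈ c+1≡i →
    proj₂ (∈-biunitaryExponents⁻ (subst (_∈ _) (sym c+1≡i) c+1∈)) (n+n≡n*2 (suc c) , z<s)
  to : i ∈ downFrom (suc (suc c * 2)) → i ∈ suc c ∷ biunitaryExponents (suc c * 2)
  to {i} i∈ with i ≟ suc c
  ... | yes refl  = here refl
  ... | no i≢c+1 = there (∈-biunitaryExponents⁺ (≤-pred (∈-downFrom⁻ i∈))
    λ (i+i≡k , _) → i≢c+1 (*-cancelʳ-≡ i (suc c) 2 (trans (sym (n+n≡n*2 i)) i+i≡k)))
  from : i ∈ suc c ∷ biunitaryExponents (suc c * 2) → i ∈ downFrom (suc (suc c * 2))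
  from (here refl) = ∈-downFrom⁺ (s≤s (m≤m*n (suc c) 2))
  from (there i∈)  = ∈-downFrom⁺ (s≤s (proj₁ (∈-biunitaryExponents⁻ i∈)))

biunitaryPowerSum-even : ¬ 2 ∣ p → ∀ k → .{{NonZero k}} → 2 ∣ biunitaryPowerSum p k
biunitaryPowerSum-even {p} p-odd k with parity k
... | inj₁ (zero , refl) = contradiction refl (≢-nonZero⁻¹ 0)
... | inj₂ (c , refl) =
  subst (λ xs → 2 ∣ sum (map (p ^_) xs)) (sym (biunitaryExponents-odd c)) (geometricSum-even p-odd (suc c))
... | inj₁ (suc c , refl) = ∣m+n∣m⇒∣n 2∣1+pᶜ⁺¹+σ (odd⇒2∣suc (prime∤-^ prime[2] p-odd (suc c)))
  where
  σ+pᶜ⁺¹ : p ^ suc c + biunitaryPowerSum p (suc c * 2) ≡ geometricSum p (suc (suc c * 2))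
  σ+pᶜ⁺¹ = sym (sum-↭ (↭.map⁺ (p ^_) (downFrom↭half∷biunitaryExponents c)))
  2∣1+pᶜ⁺¹+σ : 2 ∣ suc (p ^ suc c) + biunitaryPowerSum p (suc c * 2)
  2∣1+pᶜ⁺¹+σ = subst (2 ∣_) (cong suc (sym σ+pᶜ⁺¹))
    (∣m∣n⇒∣m+n (odd⇒2∣suc (prime∤-^ prime[2] p-odd (suc c * 2))) (geometricSum-even p-odd (suc c)))

σ**-even : ¬ 2 ∣ n → 1 < n → 2 ∣ σ** n
σ**-even {n} n-odd 1<n with prime-factor 1<n
... | q , q-prime , q∣n
  with p-adic-split-∣ {a = 1} q-prime {{>-nonZero (<-trans z<s 1<n)}} (subst (_∣ n) (sym (*-identityʳ q)) q∣n)
... | k , w , q∤w , refl = subst (2 ∣_) (sym (σ**-p^k*r q-prime q∤w (1 + k)))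
                                 (∣m⇒∣m*n (σ** w) (biunitaryPowerSum-even q-odd (1 + k)))
  where
  q-odd : ¬ 2 ∣ q
  q-odd 2∣q = n-odd (∣-trans 2∣q q∣n)

odd⇒≡1⊎σ**-even : ¬ 2 ∣ n → n ≡ 1 ⊎ 2 ∣ σ** n
odd⇒≡1⊎σ**-even {zero}        n-odd = contradiction (2 ∣0) n-odd
odd⇒≡1⊎σ**-even {suc zero}    _     = inj₁ refl
odd⇒≡1⊎σ**-even {suc (suc n)} n-odd = inj₂ (σ**-even n-odd (s≤s (s≤s z≤n)))

geometricSum-identity : ∀ q n → q * geometricSum (suc q) n + 1 ≡ suc q ^ n
geometricSum-identity q zero = cong (_+ 1) (*-zeroʳ q)
geometricSum-identity q (suc n) = begin
  q * (qⁿ + rest) + 1      ≡⟨ cong (_+ 1) (*-distribˡ-+ q qⁿ rest) ⟩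
  q * qⁿ + q * rest + 1    ≡⟨ +-assoc (q * qⁿ) (q * rest) 1 ⟩
  q * qⁿ + (q * rest + 1)  ≡⟨ cong (q * qⁿ +_) (geometricSum-identity q n) ⟩
  q * qⁿ + qⁿ              ≡⟨ +-comm (q * qⁿ) qⁿ ⟩
  suc q * qⁿ               ∎
  where
  open ≡-Reasoning
  qⁿ = suc q ^ n
  rest = geometricSum (suc q) n

biunitaryPowerSum-upper : ∀ q k → q * biunitaryPowerSum (suc q) k < suc q ^ suc k
biunitaryPowerSum-upper q k = begin-strict
  q * biunitaryPowerSum (suc q) k       <⟨ m<m+n _ z<s ⟩
  q * biunitaryPowerSum (suc q) k + 1   ≤⟨ +-monoˡ-≤ 1 (*-monoʳ-≤ q σ≤geometricSum) ⟩
  q * geometricSum (suc q) (suc k) + 1  ≡⟨ geometricSum-identity q (suc k) ⟩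
  suc q ^ suc k                         ∎
  where
  open ≤-Reasoning
  σ≤geometricSum : biunitaryPowerSum (suc q) k ≤ geometricSum (suc q) (suc k)
  σ≤geometricSum = sum-map-filter-≤ (suc q ^_) (∁? (nonzeroHalf? k)) (downFrom (suc k))

partialPowerSum : ℕ → ℕ → ℕ → ℕ
partialPowerSum p k n = sum (map (p ^_) (filter (∁? (nonzeroHalf? k)) (downFrom n)))

partialPowerSum-accept : ∀ p k n → k < n + n → partialPowerSum p k (suc n) ≡ p ^ n + partialPowerSum p k n
partialPowerSum-accept p k n k<n+n = cong (λ xs → sum (map (p ^_) xs))
  (filter-accept (∁? (nonzeroHalf? k)) {x = n} {xs = downFrom n} λ (n+n≡k , _) → <-irrefl (sym n+n≡k) k<n+n)

partialPowerSum-pos : ∀ p k n → 0 < partialPowerSum p k (suc n)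
partialPowerSum-pos p k n =
  ∈⇒≤sum _ (∈-map⁺ (p ^_) (∈-filter⁺ (∁? (nonzeroHalf? k)) (∈-downFrom⁺ {suc n} z<s) λ ()))

biunitaryPowerSum-pos : ∀ p k → 0 < biunitaryPowerSum p k
biunitaryPowerSum-pos p k = partialPowerSum-pos p k k

biunitaryPowerSum-lower : ∀ p j → suc p * p ^ (3 + j) + p ≤ p * biunitaryPowerSum p (3 + j)
biunitaryPowerSum-lower p j = begin
  suc p * p ^ (3 + j) + p                        ≡⟨ expand p (p ^ (2 + j)) ⟩
  p * (p ^ (3 + j) + (p ^ (2 + j) + 1))          ≤⟨ *-monoʳ-≤ p (+-monoʳ-≤ (p ^ (3 + j)) (+-monoʳ-≤ (p ^ (2 + j))
                                                      (partialPowerSum-pos p (3 + j) (1 + j)))) ⟩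
  p * (p ^ (3 + j) + (p ^ (2 + j) + S (2 + j)))  ≡⟨ cong (λ x → p * (p ^ (3 + j) + x))
                                                      (partialPowerSum-accept p (3 + j) (2 + j) k<2k-2) ⟨
  p * (p ^ (3 + j) + S (3 + j))                  ≡⟨ cong (p *_) (partialPowerSum-accept p (3 + j) (3 + j)
                                                      (m<m+n (3 + j) z<s)) ⟨
  p * S (4 + j)                                  ∎
  where
  open ≤-Reasoning
  S = partialPowerSum p (3 + j)
  k<2k-2 : 3 + j < (2 + j) + (2 + j)
  k<2k-2 = +-monoʳ-≤ 2 (m≤n+m (2 + j) j)
  expand : ∀ p x → suc p * (p * x) + p ≡ p * (p * x + (x + 1))
  expand = solve-∀

biunitaryPowerSum-lower₃ : ∀ p j →
  (p * p + p + 1) * p ^ (5 + j) + p * p ≤ p * p * biunitaryPowerSum p (5 + j)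
biunitaryPowerSum-lower₃ p j = begin
  (p * p + p + 1) * p ^ (5 + j) + p * p
    ≡⟨ expand p (p ^ (3 + j)) ⟩
  p * p * (p ^ (5 + j) + (p ^ (4 + j) + (p ^ (3 + j) + 1)))
    ≤⟨ *-monoʳ-≤ (p * p) (+-monoʳ-≤ (p ^ (5 + j)) (+-monoʳ-≤ (p ^ (4 + j)) (+-monoʳ-≤ (p ^ (3 + j))
         (partialPowerSum-pos p (5 + j) (2 + j))))) ⟩
  p * p * (p ^ (5 + j) + (p ^ (4 + j) + (p ^ (3 + j) + S (3 + j))))
    ≡⟨ cong (λ x → p * p * (p ^ (5 + j) + (p ^ (4 + j) + x))) (partialPowerSum-accept p (5 + j) (3 + j) k<2k-4) ⟨
  p * p * (p ^ (5 + j) + (p ^ (4 + j) + S (4 + j)))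
    ≡⟨ cong (λ x → p * p * (p ^ (5 + j) + x)) (partialPowerSum-accept p (5 + j) (4 + j) k<2k-2) ⟨
  p * p * (p ^ (5 + j) + S (5 + j))
    ≡⟨ cong (p * p *_) (partialPowerSum-accept p (5 + j) (5 + j) (m<m+n (5 + j) z<s)) ⟨
  p * p * S (6 + j)
    ∎
  where
  open ≤-Reasoning
  S = partialPowerSum p (5 + j)
  k<2k-4 : 5 + j < (3 + j) + (3 + j)
  k<2k-4 = +-monoʳ-≤ 3 (m≤n+m (3 + j) j)
  k<2k-2 : 5 + j < (4 + j) + (4 + j)
  k<2k-2 = ≤-trans k<2k-4 (+-mono-≤ (n≤1+n (3 + j)) (n≤1+n (3 + j)))
  expand : ∀ p x → (p * p + p + 1) * (p * (p * x)) + p * p ≡ p * p * (p * (p * x) + (p * x + (x + 1)))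
  expand = solve-∀

biunitaryPowerSum-lower-≢2 : ∀ p k → .{{NonZero k}} → k ≢ 2 → suc p * p ^ k ≤ p * biunitaryPowerSum p k
biunitaryPowerSum-lower-≢2 p 1 _ = ≤-reflexive (expand p)
  where
  expand : ∀ p → suc p * (p * 1) ≡ p * (p * 1 + 1)
  expand = solve-∀
biunitaryPowerSum-lower-≢2 p 2 k≢2 = contradiction refl k≢2
biunitaryPowerSum-lower-≢2 p (suc (suc (suc j))) _ = ≤-trans (m≤m+n _ p) (biunitaryPowerSum-lower p j)

-- The equation σ**(N) = 3N

-- X / x > p / q and Y / y ≥ r / s give X Y / (x y) > p r / (q s) ≥ m / k.
ratio-too-large : ∀ p q r s k m {X x Y y} → .{{NonZero k}} →
  p * x < q * X → r * y ≤ s * Y → 0 < r * y → q * s * m ≤ p * r * k → k * (X * Y) ≢ m * (x * y)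
ratio-too-large p q r s k m {X} {x} {Y} {y} px<qX ry≤sY 0<ry coefficients eq = <-irrefl refl (begin-strict
  q * s * m * (x * y)     ≤⟨ *-monoˡ-≤ (x * y) coefficients ⟩
  p * r * k * (x * y)     ≡⟨ regroup p r k x y ⟩
  k * (p * x * (r * y))   <⟨ *-monoʳ-< k (<-≤-trans (*-monoˡ-< (r * y) {{>-nonZero 0<ry}} px<qX)
                                                     (*-monoʳ-≤ (q * X) ry≤sY)) ⟩
  k * (q * X * (s * Y))   ≡⟨ regroup′ q s k X Y ⟩
  q * s * (k * (X * Y))   ≡⟨ cong (q * s *_) eq ⟩
  q * s * (m * (x * y))   ≡⟨ *-assoc (q * s) m (x * y) ⟨
  q * s * m * (x * y)     ∎)
  where
  open ≤-Reasoning
  regroup : ∀ p r k x y → p * r * k * (x * y) ≡ k * (p * x * (r * y))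
  regroup = solve-∀
  regroup′ : ∀ q s k X Y → k * (q * X * (s * Y)) ≡ q * s * (k * (X * Y))
  regroup′ = solve-∀

ratio-too-small : ∀ p q r s k m {X x Y y} → .{{NonZero m}} →
  q * X < p * x → s * Y ≤ r * y → 0 < s * Y → p * r * k ≤ q * s * m → k * (X * Y) ≢ m * (x * y)
ratio-too-small p q r s k m qX<px sY≤ry 0<sY coefficients eq =
  ratio-too-large q p s r m k qX<px sY≤ry 0<sY coefficients (sym eq)

-- What the case analysis uses about S = σ**(3 ^ f) and P = 3 ^ f for f ≥ 3;
-- f = 4 is the only exponent with S / P < 13 / 9.
record ThreeAdicPart (S P : ℕ) : Set where
  field
    S-even         : 2 ∣ S
    P-odd          : ¬ 2 ∣ P
    5∤P            : ¬ 5 ∣ P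
    13∤P           : ¬ 13 ∣ P
    upper          : 2 * S < 3 * P
    lower          : 4 * P < 3 * S
    lower-unless-4 : (S ≡ 112 × P ≡ 81) ⊎ 13 * P < 9 * S

threeAdicPart : ∀ g → ThreeAdicPart (biunitaryPowerSum 3 (3 + g)) (3 ^ (3 + g))
threeAdicPart g = record
  { S-even         = biunitaryPowerSum-even (from-no (2 ∣? 3)) (3 + g)
  ; P-odd          = prime∤-^ prime[2] (from-no (2 ∣? 3)) (3 + g)
  ; 5∤P            = prime∤-^ prime5 (from-no (5 ∣? 3)) (3 + g)
  ; 13∤P           = prime∤-^ prime13 (from-no (13 ∣? 3)) (3 + g)
  ; upper          = biunitaryPowerSum-upper 2 (3 + g)
  ; lower          = <-≤-trans (m<m+n _ z<s) (biunitaryPowerSum-lower 3 g)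
  ; lower-unless-4 = ratio-unless-4 g
  }
  where
  ratio-unless-4 : ∀ g → (biunitaryPowerSum 3 (3 + g) ≡ 112 × 3 ^ (3 + g) ≡ 81)
                         ⊎ 13 * 3 ^ (3 + g) < 9 * biunitaryPowerSum 3 (3 + g)
  ratio-unless-4 0             = inj₂ (≤ᵇ⇒≤ _ _ tt)
  ratio-unless-4 1             = inj₁ (refl , refl)
  ratio-unless-4 (suc (suc g)) = inj₂ (<-≤-trans (m<m+n _ z<s) (biunitaryPowerSum-lower₃ 3 g))

module _ {S P : ℕ} (part : ThreeAdicPart S P) where
  open ThreeAdicPart part

  no-solution-e0 : ¬ 2 ∣ t → S * σ** t ≢ 3 * (P * t)
  no-solution-e0 {t} t-odd eq =
    odd-* (from-no (2 ∣? 3)) (odd-* P-odd t-odd) (subst (2 ∣_) eq (∣m⇒∣m*n (σ** t) S-even))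

  no-solution-e1 : ¬ 2 ∣ t → S * σ** t ≢ 2 * (P * t)
  no-solution-e1 {t} t-odd eq with odd⇒≡1⊎σ**-even t-odd
  ... | inj₁ refl = ratio-too-small 3 2 1 1 1 2 {S} {P} {1} {1} upper ≤-refl z<s (≤ᵇ⇒≤ 3 4 tt)
                      (trans (*-identityˡ (S * 1)) (trans (cong (S *_) (sym σ**[1])) eq))
  ... | inj₂ σt-even = 2^[1+n]∤2^n*odd 1 (odd-* P-odd t-odd) (subst (4 ∣_) eq (*-pres-∣ S-even σt-even))

  -- The splitting happens in a local function so that `eq` is not part of the `with`
  -- expression: abstracting over it makes Agda normalise σ** of an open term, which explodes.
  no-solution-e2 : ¬ 2 ∣ t → 5 * (S * σ** t) ≢ 12 * (P * t)
  no-solution-e2 {t} t-odd eq =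
    split (prime∣-cofactor {x = S * σ** t} prime5 (from-no (5 ∣? 12)) 5∤P eq) t-odd eq
    where
    split : 5 ∣ t → ¬ 2 ∣ t → 5 * (S * σ** t) ≢ 12 * (P * t)
    split 5∣t t-odd eq with p-adic-split-∣ {a = 1} prime5 {{∤⇒nonZero t-odd}} 5∣t
    ... | k , s , 5∤s , refl with odd⇒≡1⊎σ**-even (t-odd ∘ ∣n⇒∣m*n (5 ^ (1 + k)))
    ... | inj₁ refl = ratio-too-small 3 2 5 4 5 12 {S} {P} {B} {5 ^ (1 + k)} upper
          (<⇒≤ (biunitaryPowerSum-upper 4 (1 + k))) (*-monoʳ-< 4 (biunitaryPowerSum-pos 5 (1 + k)))
          (≤ᵇ⇒≤ 75 96 tt)
          (trans (cong (λ z → 5 * (S * z)) (sym (σ**-p^k*1 prime5 (1 + k))))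
                 (trans eq (cong (λ z → 12 * (P * z)) (*-identityʳ _))))
      where B = biunitaryPowerSum 5 (1 + k)
    ... | inj₂ σs-even = 2^[1+n]∤2^n*odd 2 (odd-* (from-no (2 ∣? 3)) (odd-* P-odd t-odd))
          (subst (8 ∣_) (trans eq′ (*-assoc 4 3 (P * (5 ^ (1 + k) * s))))
                 (8∣w*[x*[y*z]] 5 S-even (biunitaryPowerSum-even (from-no (2 ∣? 5)) (1 + k)) σs-even))
      where eq′ = trans (cong (λ z → 5 * (S * z)) (sym (σ**-p^k*r prime5 5∤s (1 + k)))) eq

  no-solution-13ʰ : ∀ h → 13 * (S * biunitaryPowerSum 13 (1 + h)) ≢ 20 * (P * 13 ^ (1 + h))
  no-solution-13ʰ h with h ≟ 1 | lower-unless-4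
  ... | yes refl | _ =
    ratio-too-small 3 2 170 169 13 20 {S} {P} {170} {169} upper ≤-refl z<s (≤ᵇ⇒≤ 6630 6760 tt)
  ... | no h≢1 | inj₁ (S≡112 , P≡81) = λ eq →
    ratio-too-small 13 12 112 81 13 20 {C} {13 ^ (1 + h)} {S} {P}
      (biunitaryPowerSum-upper 12 (1 + h))
      (≤-reflexive (trans (cong (81 *_) S≡112) (cong (112 *_) (sym P≡81))))
      (subst (λ z → 0 < 81 * z) (sym S≡112) z<s) (≤ᵇ⇒≤ 18928 19440 tt)
      (trans (cong (13 *_) (*-comm C S)) (trans eq (cong (20 *_) (*-comm P _))))
    where C = biunitaryPowerSum 13 (1 + h)
  ... | no h≢1 | inj₂ 13P<9S =
    ratio-too-large 13 9 14 13 13 20 {S} {P} {biunitaryPowerSum 13 (1 + h)} {13 ^ (1 + h)} 13P<9S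
      (biunitaryPowerSum-lower-≢2 13 (1 + h) (h≢1 ∘ suc-injective))
      (*-monoʳ-< 14 (m^n>0 13 (1 + h))) (≤ᵇ⇒≤ 2340 2366 tt)

  no-solution-13 : ¬ 2 ∣ s → 13 * (S * σ** s) ≢ 20 * (P * s)
  no-solution-13 {s} s-odd eq =
    split (prime∣-cofactor {x = S * σ** s} prime13 (from-no (13 ∣? 20)) 13∤P eq) s-odd eq
    where
    split : 13 ∣ s → ¬ 2 ∣ s → 13 * (S * σ** s) ≢ 20 * (P * s)
    split 13∣s s-odd eq with p-adic-split-∣ {a = 1} prime13 {{∤⇒nonZero s-odd}} 13∣s
    ... | h , w , 13∤w , refl with odd⇒≡1⊎σ**-even (s-odd ∘ ∣n⇒∣m*n (13 ^ (1 + h)))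
    ... | inj₁ refl = no-solution-13ʰ h
          (trans (cong (λ z → 13 * (S * z)) (sym (σ**-p^k*1 prime13 (1 + h))))
                 (trans eq (cong (λ z → 20 * (P * z)) (*-identityʳ _))))
    ... | inj₂ σw-even = 2^[1+n]∤2^n*odd 2 (odd-* (from-no (2 ∣? 5)) (odd-* P-odd s-odd))
          (subst (8 ∣_) (trans eq′ (*-assoc 4 5 (P * (13 ^ (1 + h) * w))))
                 (8∣w*[x*[y*z]] 13 S-even (biunitaryPowerSum-even (from-no (2 ∣? 13)) (1 + h)) σw-even))
      where eq′ = trans (cong (λ z → 13 * (S * z)) (sym (σ**-p^k*r prime13 13∤w (1 + h)))) eq

  no-solution-e3 : ¬ 2 ∣ t → 5 * (S * σ** t) ≢ 8 * (P * t)
  no-solution-e3 {t} t-odd eq =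
    split (prime∣-cofactor {x = S * σ** t} prime5 (from-no (5 ∣? 8)) 5∤P eq) t-odd eq
    where
    split : 5 ∣ t → ¬ 2 ∣ t → 5 * (S * σ** t) ≢ 8 * (P * t)
    split 5∣t t-odd eq with p-adic-split-∣ {a = 1} prime5 {{∤⇒nonZero t-odd}} 5∣t
    ... | k , s , 5∤s , refl with k ≟ 1
    ... | yes refl = no-solution-13 (t-odd ∘ ∣n⇒∣m*n 25)
          (*-cancelˡ-≡ _ _ 10 (trans (regroup S (σ** s)) (trans eq′ (regroup′ P s))))
      where
      regroup : ∀ S σ → 10 * (13 * (S * σ)) ≡ 5 * (S * (26 * σ))
      regroup = solve-∀
      regroup′ : ∀ P s → 8 * (P * (25 * s)) ≡ 10 * (20 * (P * s))
      regroup′ = solve-∀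
      eq′ = trans (cong (λ z → 5 * (S * z)) (sym (σ**-p^k*r prime5 5∤s 2))) eq
    ... | no k≢1 = ratio-too-large 4 3 6 5 5 8 {S} {P} {B * σ** s} {5 ^ (1 + k) * s} lower (begin
            6 * (5 ^ (1 + k) * s)   ≡⟨ *-assoc 6 (5 ^ (1 + k)) s ⟨
            6 * 5 ^ (1 + k) * s     ≤⟨ *-mono-≤ (biunitaryPowerSum-lower-≢2 5 (1 + k) (k≢1 ∘ suc-injective))
                                                (σ**-≥ {{∤⇒nonZero (t-odd ∘ ∣n⇒∣m*n (5 ^ (1 + k)))}}) ⟩
            5 * B * σ** s           ≡⟨ *-assoc 5 B (σ** s) ⟩
            5 * (B * σ** s)         ∎)
          (*-monoʳ-< 6 (>-nonZero⁻¹ _ {{p^i*n≢0 prime5 5∤s (1 + k)}})) ≤-refl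
          (trans (cong (λ z → 5 * (S * z)) (sym (σ**-p^k*r prime5 5∤s (1 + k)))) eq)
      where
      open ≤-Reasoning
      B = biunitaryPowerSum 5 (1 + k)

  no-solution : ∀ e → e ≤ 3 → ¬ 2 ∣ t → biunitaryPowerSum 2 e * (S * σ** t) ≢ 3 * (2 ^ e * (P * t))
  no-solution {t} 0 _ t-odd eq = no-solution-e0 t-odd
    (trans (sym (*-identityˡ (S * σ** t))) (trans eq (cong (3 *_) (*-identityˡ (P * t)))))
  no-solution {t} 1 _ t-odd eq = no-solution-e1 t-odd (*-cancelˡ-≡ (S * σ** t) (2 * (P * t)) 3 eq)
  no-solution {t} 2 _ t-odd eq = no-solution-e2 t-odd (trans eq (sym (*-assoc 3 4 (P * t))))
  no-solution {t} 3 _ t-odd eq = no-solution-e3 t-odd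
    (*-cancelˡ-≡ (5 * (S * σ** t)) (8 * (P * t)) 3 (trans (sym (*-assoc 3 5 (S * σ** t))) eq))
  no-solution (suc (suc (suc (suc _)))) (s≤s (s≤s (s≤s ())))

lemma3p1 : (N e : ℕ) → .{{_ : NonZero N}} → σ** N ≡ 3 * N → 3 ^ 3 ∣ N →
    2 ^ e ∥ N → 4 ≤ e
lemma3p1 N e σN≡3N 27∣N 2ᵉ∥N with e ≤? 3
... | no e≰3 = ≰⇒> e≰3
... | yes e≤3 with ∥⇒p-adic-split {2} {e} 2ᵉ∥N
... | m , m-odd , refl
  with p-adic-split-∣ {a = 3} prime3 {{m*n≢0⇒n≢0 (2 ^ e)}}
         (coprime-divisor (Coprime.sym (coprime-^ˡ (prime∤⇒coprime prime[2] (from-no (2 ∣? 27))) e)) 27∣N)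
... | g , t , 3∤t , refl =
  contradiction (trans (sym σN-factorised) σN≡3N)
                (no-solution (threeAdicPart g) e e≤3 (m-odd ∘ ∣n⇒∣m*n (3 ^ (3 + g))))
  where
  σN-factorised : σ** (2 ^ e * (3 ^ (3 + g) * t))
                ≡ biunitaryPowerSum 2 e * (biunitaryPowerSum 3 (3 + g) * σ** t)
  σN-factorised = trans (σ**-p^k*r prime[2] m-odd e)
                        (cong (biunitaryPowerSum 2 e *_) (σ**-p^k*r prime3 3∤t (3 + g)))
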